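{- For any two transformation graphs $G_1,G_2$ without cycles of negative weight, we have $\big||G_1|\odot|G_2|\big|=|G_1\odot G_2|$.
   Context: Clocks: a finite set $X$ with reference clock $x_0$. A transformation graph is a weighted digraph on $\{0,\dots,k\}\times X$ (columns $0,\dots,k$) with weights $(\preccurlyeq,d)$, $\preccurlyeq\in\{<,\le\}$, $d\in\mathbb{Z}$. Weights add as $(\preccurlyeq_1,d_1)+(\preccurlyeq_2,d_2)=(\preccurlyeq,d_1+d_2)$, where $\preccurlyeq$ is $\le$ iff both are $\le$; they are ordered by $d$, with $(<,d)$ below $(\le,d)$; a cycle is negative if its weight is below $(\le,0)$. The canonical form of a graph $G$ without negative cycle has, for every pair of distinct vertices joined by a path, an edge whose weight is the minimal weight of such a path. The short graph $|G|$ (defined only when $G$ has no negative cycle) is the canonical form of $G$ restricted to its leftmost and rightmost columns, renumbered $0$ and $1$. Composition: if $G_1,G_2$ have $k_1,k_2$ columns, $G_1\odot G_2$ has vertex set $\{0,\dots,k_1+k_2-1\}\times X$, the edges of $G_1$ among columns $<k_1$, the edges of $G_2$ (shifted by $k_1$) among columns $\ge k_1$, and edges of weight $(\le,0)$ from $(k_1-1,x)$ to $(k_1,x)$ and from $(k_1,x)$ to $(k_1-1,x)$ for every $x\in X$. -}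

module Defs where

open import Data.Nat using (ℕ; suc) renaming (_≟_ to _≟ℕ_)
open import Data.Integer using (ℤ; +_) renaming (_+_ to _+ℤ_; _<_ to _<ℤ_)
open import Data.Fin using (Fin; zero; suc; fromℕ; splitAt; toℕ) renaming (_≟_ to _≟F_)
open import Data.Product using (Σ; _×_; _,_)
open import Data.Sum using (_⊎_; inj₁; inj₂)
open import Data.Maybe using (Maybe; just; nothing)
open import Relation.Binary.PropositionalEquality using (_≡_; _≢_)
open import Relation.Nullary using (¬_; yes; no)

data Strictness : Set where
  lt le : Strictness

_∧s_ : Strictness → Strictness → Strictness
le ∧s le = le
_  ∧s _  = lt

record Weight : Set where
  constructor w⟨_,_⟩
  field
    rel : Strictness
    val : ℤ

open Weight public

_+w_ : Weight → Weight → Weight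
w⟨ s₁ , d₁ ⟩ +w w⟨ s₂ , d₂ ⟩ = w⟨ s₁ ∧s s₂ , d₁ +ℤ d₂ ⟩

data _<w_ : Weight → Weight → Set where
  <-val : ∀ {s₁ s₂ d₁ d₂} → d₁ <ℤ d₂ → w⟨ s₁ , d₁ ⟩ <w w⟨ s₂ , d₂ ⟩
  <-rel : ∀ {d} → w⟨ lt , d ⟩ <w w⟨ le , d ⟩

_≤w_ : Weight → Weight → Set
a ≤w b = a <w b ⊎ a ≡ b

zeroW : Weight
zeroW = w⟨ le , + 0 ⟩

-- Vertices of a graph with k columns (columns 0 … k-1) over clocks Fin n
V : ℕ → ℕ → Set
V k n = Fin k × Fin n

Graph : ℕ → ℕ → Set
Graph k n = V k n → V k n → Maybe Weight

data Path {k n : ℕ} (G : Graph k n) : V k n → V k n → Set where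
  edge : ∀ {u v w} → G u v ≡ just w → Path G u v
  step : ∀ {u t v w} → G u t ≡ just w → Path G t v → Path G u v

weight : ∀ {k n} {G : Graph k n} {u v} → Path G u v → Weight
weight (edge {w = w} _)   = w
weight (step {w = w} _ p) = w +w weight p

NoNegCycle : ∀ {k n} → Graph k n → Set
NoNegCycle {k} {n} G = ∀ (v : V k n) (p : Path G v v) → ¬ (weight p <w zeroW)

CanonEntry : ∀ {k n} → Graph k n → V k n → V k n → Maybe Weight → Set
CanonEntry G u v nothing  = u ≡ v ⊎ ¬ Path G u v
CanonEntry G u v (just w) =
  u ≢ v × Σ (Path G u v) (λ p → weight p ≡ w) × (∀ (q : Path G u v) → w ≤w weight q)

IsCanonical : ∀ {k n} → Graph k n → Graph k n → Set
IsCanonical {k} {n} G C = ∀ (u v : V k n) → CanonEntry G u v (C u v)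

ends : ∀ m → Fin 2 → Fin (suc (suc m))
ends m zero = zero
ends m (suc zero) = fromℕ (suc m)

IsShort : ∀ {m n} → Graph (suc (suc m)) n → Graph 2 n → Set
IsShort {m} {n} G S =
  Σ (Graph (suc (suc m)) n) λ C → IsCanonical G C ×
    (∀ (i : Fin 2) (x : Fin n) (j : Fin 2) (y : Fin n) →
       S (i , x) (j , y) ≡ C (ends m i , x) (ends m j , y))

-- (≤,0)-link between (last column of G₁, x) and (first column of G₂, y)
link : ∀ {m₁ k₂ n} → Fin (suc m₁) → Fin k₂ → Fin n → Fin n → Maybe Weight
link {m₁} a zero x y with toℕ a ≟ℕ m₁ | x ≟F y
... | yes _ | yes _ = just zeroW
... | _     | _     = nothing
link a (suc _) x y = nothing

_⊙_ : ∀ {m₁ k₂ n} → Graph (suc m₁) n → Graph k₂ n → Graph (suc m₁ Data.Nat.+ k₂) n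
_⊙_ {m₁} G₁ G₂ (i , x) (j , y) with splitAt (suc m₁) i | splitAt (suc m₁) j
... | inj₁ a | inj₁ b = G₁ (a , x) (b , y)
... | inj₂ a | inj₂ b = G₂ (a , x) (b , y)
... | inj₁ a | inj₂ b = link a b x y
... | inj₂ a | inj₁ b = link b a y x

-- Every walk in G₁ ⊙ G₂ splits at the link edges into segments inside G₁ or G₂. A segment
-- joining extreme columns of Gᵢ weighs at least the corresponding edge of the short graph Sᵢ,
-- and every edge of Sᵢ is the weight of a path in Gᵢ. So walks between extreme columns move
-- between S₁ ⊙ S₂ and G₁ ⊙ G₂ in both directions without gaining weight; a cycle of G₁ ⊙ G₂
-- either stays inside one Gᵢ or can be rotated to start at the link and then shortened to a
-- cycle of S₁ ⊙ S₂. Hence the canonical form of G₁ ⊙ G₂ (which exists by Floyd–Warshall),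
-- restricted to the extreme columns of G₁ and G₂, is also a canonical form of S₁ ⊙ S₂.

module Submission where

open import Defs
open import Data.Empty using (⊥; ⊥-elim)
open import Data.Fin using (Fin; zero; suc; toℕ; fromℕ; splitAt; _↑ˡ_; _↑ʳ_)
open import Data.Fin.Properties
  using (toℕ-injective; toℕ-fromℕ; toℕ-↑ʳ; splitAt-↑ˡ; splitAt-↑ʳ; splitAt⁻¹-↑ˡ; splitAt⁻¹-↑ʳ)
  renaming (_≟_ to _≟ᶠ_)
import Data.Integer.Properties as ℤ
open import Data.List using (List; []; _∷_; allFin; cartesianProduct)
open import Data.List.Membership.Propositional using (_∈_)
open import Data.List.Membership.Propositional.Properties using (∈-allFin; ∈-cartesianProduct⁺)
open import Data.List.Relation.Unary.Any using (here; there)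
open import Data.Maybe using (Maybe; just; nothing)
open import Data.Nat using (ℕ; zero; suc; _+_) renaming (_≟_ to _≟ℕ_)
open import Data.Nat.Properties using (+-suc)
open import Data.Product using (Σ; ∃; _×_; _,_; proj₁; proj₂; map₂)
open import Data.Product.Properties using (,-injectiveˡ; ≡-dec)
open import Data.Sum using (_⊎_; inj₁; inj₂)
open import Data.Unit using (⊤; tt)
open import Function.Base using (_∘_; _∋_)
open import Function.Bundles using (_⇔_; mk⇔)
open import Relation.Binary.Bundles using (Poset)
open import Relation.Binary.Construct.Closure.ReflexiveTransitive using (Star; ε; _◅_; _◅◅_; gmap)
import Relation.Binary.Construct.StrictToNonStrict as StrictToNonStrict
open import Relation.Binary.Definitions using (Trichotomous; Tri; tri<; tri≈; tri>)
open import Relation.Binary.PropositionalEquality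
import Relation.Binary.Reasoning.PartialOrder
open import Relation.Binary.Structures using (IsStrictTotalOrder; IsTotalOrder)
open import Relation.Nullary using (¬_; Dec; yes; no)

<w-trans : ∀ {a b c} → a <w b → b <w c → a <w c
<w-trans (<-val p) (<-val q) = <-val (ℤ.<-trans p q)
<w-trans (<-val p) <-rel     = <-val p
<w-trans <-rel     (<-val q) = <-val q

<w-irrefl : ∀ {a b} → a ≡ b → ¬ (a <w b)
<w-irrefl refl (<-val p) = ℤ.<-irrefl refl p

<w-asym : ∀ {a b} → a <w b → ¬ (b <w a)
<w-asym a<b b<a = <w-irrefl refl (<w-trans a<b b<a)

tri-< : ∀ {a b} → a <w b → Tri (a <w b) (a ≡ b) (b <w a)
tri-< a<b = tri< a<b (λ a≡b → <w-irrefl a≡b a<b) (<w-asym a<b)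

tri-> : ∀ {a b} → b <w a → Tri (a <w b) (a ≡ b) (b <w a)
tri-> b<a = tri> (<w-asym b<a) (λ a≡b → <w-irrefl (sym a≡b) b<a) b<a

<w-compare : Trichotomous _≡_ _<w_
<w-compare w⟨ s , d ⟩ w⟨ s′ , d′ ⟩ with ℤ.<-cmp d d′
... | tri< d<d′ _ _ = tri-< (<-val d<d′)
... | tri> _ _ d>d′ = tri-> (<-val d>d′)
<w-compare w⟨ lt , d ⟩ w⟨ lt , d ⟩ | tri≈ _ refl _ = tri≈ (<w-irrefl refl) refl (<w-irrefl refl)
<w-compare w⟨ lt , d ⟩ w⟨ le , d ⟩ | tri≈ _ refl _ = tri-< <-rel
<w-compare w⟨ le , d ⟩ w⟨ lt , d ⟩ | tri≈ _ refl _ = tri-> <-rel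
<w-compare w⟨ le , d ⟩ w⟨ le , d ⟩ | tri≈ _ refl _ = tri≈ (<w-irrefl refl) refl (<w-irrefl refl)

<w-isStrictTotalOrder : IsStrictTotalOrder _≡_ _<w_
<w-isStrictTotalOrder = record
  { isStrictPartialOrder = record
    { isEquivalence = isEquivalence
    ; irrefl = <w-irrefl
    ; trans = <w-trans
    ; <-resp-≈ = (λ { refl a<b → a<b }) , (λ { refl a<b → a<b })
    }
  ; compare = <w-compare
  }

≤w-isTotalOrder : IsTotalOrder _≡_ _≤w_
≤w-isTotalOrder = StrictToNonStrict.isTotalOrder _≡_ _<w_ <w-isStrictTotalOrder

open IsTotalOrder ≤w-isTotalOrder public
  using ()
  renaming (total to ≤w-total; refl to ≤w-refl; reflexive to ≤w-reflexive; trans to ≤w-trans; antisym to ≤w-antisym)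

≤w-poset : Poset _ _ _
≤w-poset = record { isPartialOrder = IsTotalOrder.isPartialOrder ≤w-isTotalOrder }

module ≤w-Reasoning = Relation.Binary.Reasoning.PartialOrder ≤w-poset

∧s-assoc : ∀ s₁ s₂ s₃ → ((s₁ ∧s s₂) ∧s s₃) ≡ (s₁ ∧s (s₂ ∧s s₃))
∧s-assoc lt _  _  = refl
∧s-assoc le lt _  = refl
∧s-assoc le le lt = refl
∧s-assoc le le le = refl

∧s-comm : ∀ s₁ s₂ → (s₁ ∧s s₂) ≡ (s₂ ∧s s₁)
∧s-comm lt lt = refl
∧s-comm lt le = refl
∧s-comm le lt = refl
∧s-comm le le = refl

+w-assoc : ∀ a b c → ((a +w b) +w c) ≡ (a +w (b +w c))
+w-assoc a b c = cong₂ w⟨_,_⟩ (∧s-assoc (rel a) (rel b) (rel c)) (ℤ.+-assoc (val a) (val b) (val c))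

+w-comm : ∀ a b → (a +w b) ≡ (b +w a)
+w-comm a b = cong₂ w⟨_,_⟩ (∧s-comm (rel a) (rel b)) (ℤ.+-comm (val a) (val b))

+w-identityˡ : ∀ a → (zeroW +w a) ≡ a
+w-identityˡ w⟨ lt , d ⟩ = cong w⟨ lt ,_⟩ (ℤ.+-identityˡ d)
+w-identityˡ w⟨ le , d ⟩ = cong w⟨ le ,_⟩ (ℤ.+-identityˡ d)

+w-identityʳ : ∀ a → (a +w zeroW) ≡ a
+w-identityʳ a = trans (+w-comm a zeroW) (+w-identityˡ a)

+w-monoˡ-≤ : ∀ c {a b} → a ≤w b → (a +w c) ≤w (b +w c)
+w-monoˡ-≤ c (inj₂ refl) = ≤w-refl
+w-monoˡ-≤ c (inj₁ (<-val d<d′)) = inj₁ (<-val (ℤ.+-monoˡ-< (val c) d<d′))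
+w-monoˡ-≤ w⟨ lt , _ ⟩ (inj₁ <-rel) = inj₂ refl
+w-monoˡ-≤ w⟨ le , _ ⟩ (inj₁ <-rel) = inj₁ <-rel

+w-monoʳ-≤ : ∀ c {a b} → a ≤w b → (c +w a) ≤w (c +w b)
+w-monoʳ-≤ c {a} {b} a≤b =
  subst₂ _≤w_ (+w-comm a c) (+w-comm b c) (+w-monoˡ-≤ c a≤b)

+w-mono-≤ : ∀ {a a′ b b′} → a ≤w a′ → b ≤w b′ → (a +w b) ≤w (a′ +w b′)
+w-mono-≤ {a′ = a′} {b} a≤a′ b≤b′ = ≤w-trans (+w-monoˡ-≤ b a≤a′) (+w-monoʳ-≤ a′ b≤b′)

≮0⇒≥0 : ∀ {a} → ¬ (a <w zeroW) → zeroW ≤w a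
≮0⇒≥0 {a} a≮0 with <w-compare a zeroW
... | tri< a<0 _ _ = ⊥-elim (a≮0 a<0)
... | tri≈ _ a≡0 _ = ≤w-reflexive (sym a≡0)
... | tri> _ _ 0<a = inj₁ 0<a

≥0⇒≮0 : ∀ {a} → zeroW ≤w a → ¬ (a <w zeroW)
≥0⇒≮0 (inj₁ 0<a) = <w-asym 0<a
≥0⇒≮0 (inj₂ refl) = <w-irrefl refl

Walk : ∀ {A : Set} → (A → A → Weight → Set) → A → A → Set
Walk E = Star (λ u v → ∃ (E u v))

module _ {A : Set} {E : A → A → Weight → Set} where

  walkWeight : ∀ {u v} → Walk E u v → Weight
  walkWeight ε             = zeroW
  walkWeight ((w , _) ◅ p) = w +w walkWeight p

  walkWeight-◅◅ : ∀ {u t v} (p : Walk E u t) (q : Walk E t v) →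
                  walkWeight (p ◅◅ q) ≡ (walkWeight p +w walkWeight q)
  walkWeight-◅◅ ε             q = sym (+w-identityˡ (walkWeight q))
  walkWeight-◅◅ ((w , _) ◅ p) q = trans (cong (w +w_) (walkWeight-◅◅ p q)) (sym (+w-assoc w _ _))

  walkWeight-snoc : ∀ {u t v w} (p : Walk E u t) (e : E t v w) W →
                    (walkWeight (p ◅◅ ((w , e) ◅ ε)) +w W) ≡ (walkWeight p +w (w +w W))
  walkWeight-snoc {w = w} p e W = begin
    (walkWeight (p ◅◅ ((w , e) ◅ ε)) +w W)   ≡⟨ cong (_+w W) (walkWeight-◅◅ p _) ⟩
    ((walkWeight p +w (w +w zeroW)) +w W)    ≡⟨ cong (λ d → (walkWeight p +w d) +w W) (+w-identityʳ w) ⟩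
    ((walkWeight p +w w) +w W)               ≡⟨ +w-assoc (walkWeight p) w W ⟩
    (walkWeight p +w (w +w W))               ∎
    where open ≡-Reasoning

  WalkAtMost : A → A → Weight → Set
  WalkAtMost u v W = Σ (Walk E u v) (λ p → walkWeight p ≤w W)

  atMost-weaken : ∀ {u v W W′} → W ≤w W′ → WalkAtMost u v W → WalkAtMost u v W′
  atMost-weaken W≤W′ (p , p≤W) = p , ≤w-trans p≤W W≤W′

  atMost-◅ : ∀ {u t v w W} → E u t w → WalkAtMost t v W → WalkAtMost u v (w +w W)
  atMost-◅ {w = w} e (p , p≤W) = (w , e) ◅ p , +w-monoʳ-≤ w p≤W

  atMost-◅◅ : ∀ {u t v W₁ W₂} → WalkAtMost u t W₁ → WalkAtMost t v W₂ →
              WalkAtMost u v (W₁ +w W₂)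
  atMost-◅◅ (p , p≤W₁) (q , q≤W₂) =
    p ◅◅ q , subst (_≤w _) (sym (walkWeight-◅◅ p q)) (+w-mono-≤ p≤W₁ q≤W₂)

module _ {A B : Set} {E : A → A → Weight → Set} {F : B → B → Weight → Set} where

  atMost-via : ∀ {a b a′ b′} → (∀ (p : Walk E a b) → WalkAtMost {E = F} a′ b′ (walkWeight p)) →
               ∀ {W} → WalkAtMost {E = E} a b W → WalkAtMost {E = F} a′ b′ W
  atMost-via transfer (p , p≤W) with transfer p
  ... | q , q≤p = q , ≤w-trans q≤p p≤W

module _ {A B : Set} {E : A → A → Weight → Set} {F : B → B → Weight → Set}
         (f : A → B) (f-edge : ∀ {u v w} → E u v w → F (f u) (f v) w) where

  mapWalk : ∀ {u v} → Walk E u v → Walk F (f u) (f v)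
  mapWalk = gmap f (map₂ f-edge)

  walkWeight-map : ∀ {u v} (p : Walk E u v) → walkWeight (mapWalk p) ≡ walkWeight p
  walkWeight-map ε             = refl
  walkWeight-map ((w , _) ◅ p) = cong (w +w_) (walkWeight-map p)

  atMost-map : ∀ {u v W} → WalkAtMost {E = E} u v W → WalkAtMost {E = F} (f u) (f v) W
  atMost-map (p , p≤W) = mapWalk p , subst (_≤w _) (sym (walkWeight-map p)) p≤W

NoNegClosedWalk : ∀ {A : Set} → (A → A → Weight → Set) → Set
NoNegClosedWalk E = ∀ {u} (p : Walk E u u) → zeroW ≤w walkWeight p

noNegClosedWalk-reflect : ∀ {A B : Set} {E : A → A → Weight → Set} {F : B → B → Weight → Set}
                          (f : B → A) →
                          (∀ {u v} (p : Walk F u v) → WalkAtMost {E = E} (f u) (f v) (walkWeight p)) →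
                          NoNegClosedWalk E → NoNegClosedWalk F
noNegClosedWalk-reflect f transfer noNeg p with transfer p
... | q , q≤p = ≤w-trans (noNeg q) q≤p

Edge : ∀ {k n} → Graph k n → V k n → V k n → Weight → Set
Edge G u v w = G u v ≡ just w

module _ {k n} {G : Graph k n} where

  pathToWalk : ∀ {u v} → Path G u v → Walk (Edge G) u v
  pathToWalk (edge {w = w} e)   = (w , e) ◅ ε
  pathToWalk (step {w = w} e p) = (w , e) ◅ pathToWalk p

  walkWeight-pathToWalk : ∀ {u v} (p : Path G u v) → walkWeight (pathToWalk p) ≡ weight p
  walkWeight-pathToWalk (edge {w = w} _)   = +w-identityʳ w
  walkWeight-pathToWalk (step {w = w} _ p) = cong (w +w_) (walkWeight-pathToWalk p)

  walkToPath : ∀ {u t v w} → Edge G u t w → (p : Walk (Edge G) t v) →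
               Σ (Path G u v) (λ q → weight q ≡ (w +w walkWeight p))
  walkToPath {w = w} e ε = edge e , sym (+w-identityʳ w)
  walkToPath {w = w} e ((_ , e′) ◅ p) with walkToPath e′ p
  ... | q , q≡p = step e q , cong (w +w_) q≡p

  nonemptyWalkToPath : ∀ {u v} → u ≢ v → (p : Walk (Edge G) u v) →
                       Σ (Path G u v) (λ q → weight q ≡ walkWeight p)
  nonemptyWalkToPath u≢v ε             = ⊥-elim (u≢v refl)
  nonemptyWalkToPath _   ((_ , e) ◅ p) = walkToPath e p

  noNegCycle⇒noNegClosedWalk : NoNegCycle G → NoNegClosedWalk (Edge G)
  noNegCycle⇒noNegClosedWalk noNeg ε             = ≤w-refl
  noNegCycle⇒noNegClosedWalk noNeg ((_ , e) ◅ p) with walkToPath e p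
  ... | q , q≡p = subst (zeroW ≤w_) q≡p (≮0⇒≥0 (noNeg _ q))

  noNegClosedWalk⇒noNegCycle : NoNegClosedWalk (Edge G) → NoNegCycle G
  noNegClosedWalk⇒noNegCycle noNeg v p =
    ≥0⇒≮0 (subst (zeroW ≤w_) (walkWeight-pathToWalk p) (noNeg (pathToWalk p)))

-- Canonical forms

_⊓ᴹ_ : Maybe Weight → Maybe Weight → Maybe Weight
nothing ⊓ᴹ b       = b
just a  ⊓ᴹ nothing = just a
just a  ⊓ᴹ just b  with ≤w-total a b
... | inj₁ _ = just a
... | inj₂ _ = just b

_+ᴹ_ : Maybe Weight → Maybe Weight → Maybe Weight
just a +ᴹ just b = just (a +w b)
_      +ᴹ _      = nothing

_≤ᴹ_ : Maybe Weight → Weight → Set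
nothing ≤ᴹ _ = ⊥
just a  ≤ᴹ w = a ≤w w

⊓ᴹ-≤ˡ : ∀ a b {w} → a ≤ᴹ w → (a ⊓ᴹ b) ≤ᴹ w
⊓ᴹ-≤ˡ (just a) nothing  a≤w = a≤w
⊓ᴹ-≤ˡ (just a) (just b) a≤w with ≤w-total a b
... | inj₁ _   = a≤w
... | inj₂ b≤a = ≤w-trans b≤a a≤w

⊓ᴹ-≤ʳ : ∀ a b {w} → b ≤ᴹ w → (a ⊓ᴹ b) ≤ᴹ w
⊓ᴹ-≤ʳ nothing  b        b≤w = b≤w
⊓ᴹ-≤ʳ (just a) (just b) b≤w with ≤w-total a b
... | inj₁ a≤b = ≤w-trans a≤b b≤w
... | inj₂ _   = b≤w

+ᴹ-≤ : ∀ a b {v w} → a ≤ᴹ v → b ≤ᴹ w → (a +ᴹ b) ≤ᴹ (v +w w)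
+ᴹ-≤ (just a) (just b) = +w-mono-≤

≤ᴹ-trans : ∀ a {v w} → a ≤ᴹ v → v ≤w w → a ≤ᴹ w
≤ᴹ-trans (just a) = ≤w-trans

module _ {k n} {G : Graph k n} where

  _++ᴾ_ : ∀ {u t v} → Path G u t → Path G t v → Path G u v
  edge e   ++ᴾ q = step e q
  step e p ++ᴾ q = step e (p ++ᴾ q)

  weight-++ᴾ : ∀ {u t v} (p : Path G u t) (q : Path G t v) →
               weight (p ++ᴾ q) ≡ (weight p +w weight q)
  weight-++ᴾ (edge e)           q = refl
  weight-++ᴾ (step {w = w} e p) q = trans (cong (w +w_) (weight-++ᴾ p q)) (sym (+w-assoc w _ _))

  Through : List (V k n) → ∀ {u v} → Path G u v → Set
  Through R (edge _)           = ⊤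
  Through R (step {t = t} _ p) = t ∈ R × Through R p

  through-all : ∀ {R} → (∀ t → t ∈ R) → ∀ {u v} (p : Path G u v) → Through R p
  through-all all (edge _)           = tt
  through-all all (step {t = t} _ p) = all t , through-all all p

module FloydWarshall {k n} (G : Graph k n) (noNeg : NoNegCycle G) where

  Realised : V k n → V k n → Maybe Weight → Set
  Realised u v nothing  = ⊤
  Realised u v (just w) = Σ (Path G u v) (λ p → weight p ≡ w)

  realised-⊓ᴹ : ∀ {u v} a b → Realised u v a → Realised u v b → Realised u v (a ⊓ᴹ b)
  realised-⊓ᴹ nothing  b        _  rb = rb
  realised-⊓ᴹ (just a) nothing  ra _  = ra
  realised-⊓ᴹ (just a) (just b) ra rb with ≤w-total a b
  ... | inj₁ _ = ra
  ... | inj₂ _ = rb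

  realised-+ᴹ : ∀ {u t v} a b → Realised u t a → Realised t v b → Realised u v (a +ᴹ b)
  realised-+ᴹ nothing  _        _          _          = tt
  realised-+ᴹ (just a) nothing  _          _          = tt
  realised-+ᴹ (just a) (just b) (p , refl) (q , refl) = p ++ᴾ q , weight-++ᴾ p q

  dist : List (V k n) → V k n → V k n → Maybe Weight
  dist []      u v = G u v
  dist (r ∷ R) u v = dist R u v ⊓ᴹ (dist R u r +ᴹ dist R r v)

  dist-realised : ∀ R u v → Realised u v (dist R u v)
  dist-realised [] u v with G u v in e
  ... | nothing = tt
  ... | just w  = edge e , refl
  dist-realised (r ∷ R) u v =
    realised-⊓ᴹ (dist R u v) _ (dist-realised R u v)
      (realised-+ᴹ (dist R u r) (dist R r v) (dist-realised R u r) (dist-realised R r v))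

  -- cutting out the cycles between repeated visits of r needs the absence of negative cycles
  split : ∀ r R {u v} (p : Path G u v) → Through (r ∷ R) p →
          Through R p ⊎ Σ (Path G u r) λ p₁ → Σ (Path G r v) λ p₂ →
            Through R p₁ × Through R p₂ × ((weight p₁ +w weight p₂) ≤w weight p)
  split r R (edge _) _ = inj₁ tt
  split r R (step {w = w} e p) (here refl , through) with split r R p through
  ... | inj₁ throughR = inj₂ (edge e , p , tt , throughR , ≤w-refl)
  ... | inj₂ (p₁ , p₂ , _ , through₂ , p₁p₂≤p) =
    inj₂ (edge e , p₂ , tt , through₂ , +w-monoʳ-≤ w p₂≤p)
    where
      open ≤w-Reasoning
      p₂≤p : weight p₂ ≤w weight p
      p₂≤p = begin
        weight p₂                   ≡⟨ sym (+w-identityˡ _) ⟩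
        (zeroW +w weight p₂)        ≤⟨ +w-monoˡ-≤ _ (≮0⇒≥0 (noNeg r p₁)) ⟩
        (weight p₁ +w weight p₂)    ≤⟨ p₁p₂≤p ⟩
        weight p                    ∎
  split r R (step {w = w} e p) (there t∈R , through) with split r R p through
  ... | inj₁ throughR = inj₁ (t∈R , throughR)
  ... | inj₂ (p₁ , p₂ , through₁ , through₂ , p₁p₂≤p) =
    inj₂ (step e p₁ , p₂ , (t∈R , through₁) , through₂ ,
          ≤w-trans (≤w-reflexive (+w-assoc w _ _)) (+w-monoʳ-≤ w p₁p₂≤p))

  dist-minimal : ∀ R {u v} (p : Path G u v) → Through R p → dist R u v ≤ᴹ weight p
  dist-minimal [] (edge e) _ rewrite e = ≤w-refl
  dist-minimal (r ∷ R) {u} {v} p through with split r R p through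
  ... | inj₁ throughR = ⊓ᴹ-≤ˡ (dist R u v) _ (dist-minimal R p throughR)
  ... | inj₂ (p₁ , p₂ , through₁ , through₂ , p₁p₂≤p) =
    ⊓ᴹ-≤ʳ (dist R u v) _
      (≤ᴹ-trans (dist R u r +ᴹ dist R r v)
        (+ᴹ-≤ (dist R u r) (dist R r v) (dist-minimal R p₁ through₁) (dist-minimal R p₂ through₂))
        p₁p₂≤p)

_≟ⱽ_ : ∀ {k n} (u v : V k n) → Dec (u ≡ v)
_≟ⱽ_ = ≡-dec _≟ᶠ_ _≟ᶠ_

canonicalForm : ∀ {k n} (G : Graph k n) → NoNegCycle G → Σ (Graph k n) (IsCanonical G)
canonicalForm {k} {n} G noNeg = C , C-canonical
  where
    open FloydWarshall G noNeg

    vertices : List (V k n)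
    vertices = cartesianProduct (allFin k) (allFin n)

    ∈-vertices : ∀ v → v ∈ vertices
    ∈-vertices (i , x) = ∈-cartesianProduct⁺ (∈-allFin i) (∈-allFin x)

    C : Graph k n
    C u v with u ≟ⱽ v
    ... | yes _ = nothing
    ... | no  _ = dist vertices u v

    C-canonical : IsCanonical G C
    C-canonical u v with u ≟ⱽ v
    ... | yes u≡v = inj₁ u≡v
    ... | no  u≢v with dist vertices u v | dist-realised vertices u v | dist-minimal vertices {u} {v}
    ...   | nothing | _         | minimal = inj₂ λ p → minimal p (through-all ∈-vertices p)
    ...   | just w  | (p , p≡w) | minimal = u≢v , (p , p≡w) , λ q → minimal q (through-all ∈-vertices q)

PathAtMost : ∀ {k n} → Graph k n → V k n → V k n → Weight → Set
PathAtMost G u v W = Σ (Path G u v) (λ p → weight p ≤w W)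

pathAtMost-via : ∀ {k n k′ n′} {G : Graph k n} {H : Graph k′ n′} {a b a′ b′} → a′ ≢ b′ →
                 (∀ (p : Walk (Edge H) a b) → WalkAtMost {E = Edge G} a′ b′ (walkWeight p)) →
                 (p : Path H a b) → PathAtMost G a′ b′ (weight p)
pathAtMost-via a′≢b′ transfer p with transfer (pathToWalk p)
... | q , q≤p with nonemptyWalkToPath a′≢b′ q
...   | r , r≡q = r , subst₂ _≤w_ (sym r≡q) (walkWeight-pathToWalk p) q≤p

IsCanonical-pullback :
  ∀ {k n k′ n′} {G : Graph k n} {H : Graph k′ n′} {C : Graph k n} (f : V k′ n′ → V k n) →
  (∀ {u v} → f u ≡ f v → u ≡ v) →
  (∀ {u v} → u ≢ v → (p : Path H u v) → PathAtMost G (f u) (f v) (weight p)) →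
  (∀ {u v} → u ≢ v → (p : Path G (f u) (f v)) → PathAtMost H u v (weight p)) →
  IsCanonical G C → IsCanonical H (λ u v → C (f u) (f v))
IsCanonical-pullback {C = C} f f-injective expand contract C-canonical u v
  with C (f u) (f v) | C-canonical (f u) (f v)
... | nothing | inj₁ fu≡fv = inj₁ (f-injective fu≡fv)
... | nothing | inj₂ noPath with u ≟ⱽ v
...   | yes u≡v = inj₁ u≡v
...   | no  u≢v = inj₂ λ p → noPath (proj₁ (expand u≢v p))
IsCanonical-pullback {H = H} f f-injective expand contract C-canonical u v
    | just w | fu≢fv , (p , p≡w) , minimal =
  u≢v , (q , ≤w-antisym (subst (weight q ≤w_) p≡w q≤p) (w≤ q)) , w≤
  where
    u≢v : u ≢ v
    u≢v = fu≢fv ∘ cong f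

    w≤ : (q′ : Path H u v) → w ≤w weight q′
    w≤ q′ with expand u≢v q′
    ... | r , r≤q′ = ≤w-trans (minimal r) r≤q′

    contracted : PathAtMost H u v (weight p)
    contracted = contract u≢v p

    q : Path H u v
    q = proj₁ contracted

    q≤p : weight q ≤w weight p
    q≤p = proj₂ contracted

-- Short graphs

ends-injective : ∀ m {i j} → ends m i ≡ ends m j → i ≡ j
ends-injective m {zero}     {zero}     _ = refl
ends-injective m {suc zero} {suc zero} _ = refl
ends-injective m {zero}     {suc zero} ()
ends-injective m {suc zero} {zero}     ()

ends×-injective : ∀ m {n} {i j} {x y : Fin n} → (ends m i , x) ≡ (ends m j , y) → (i , x) ≡ (j , y)
ends×-injective m eq = cong₂ _,_ (ends-injective m (cong proj₁ eq)) (cong proj₂ eq)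

module _ {m n} {G : Graph (suc (suc m)) n} {S : Graph 2 n} where

  shortEdge-walk : IsShort G S → ∀ {i x j y w} → Edge S (i , x) (j , y) w →
                   WalkAtMost {E = Edge G} (ends m i , x) (ends m j , y) w
  shortEdge-walk (C , C-canonical , S≡C) {i} {x} {j} {y} e
    with C (ends m i , x) (ends m j , y) | C-canonical (ends m i , x) (ends m j , y) | trans (sym (S≡C i x j y)) e
  ... | just _ | _ , (p , refl) , _ | refl = pathToWalk p , ≤w-reflexive (walkWeight-pathToWalk p)

  shortcut : IsShort G S → NoNegCycle G → ∀ {i x j y} (p : Walk (Edge G) (ends m i , x) (ends m j , y)) →
             WalkAtMost {E = Edge S} (i , x) (j , y) (walkWeight p)
  shortcut (C , C-canonical , S≡C) noNeg {i} {x} {j} {y} p with (i , x) ≟ⱽ (j , y)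
  ... | yes refl = ε , noNegCycle⇒noNegClosedWalk noNeg p
  ... | no ix≢jy with C (ends m i , x) (ends m j , y) in C≡ | C-canonical (ends m i , x) (ends m j , y)
  ...   | nothing | inj₁ same   = ⊥-elim (ix≢jy (ends×-injective m same))
  ...   | nothing | inj₂ noPath = ⊥-elim (noPath (proj₁ (nonemptyWalkToPath (ix≢jy ∘ ends×-injective m) p)))
  ...   | just w  | _ , _ , minimal =
          atMost-weaken w≤p (atMost-◅ (trans (S≡C i x j y) C≡) (ε , ≤w-refl))
    where
      w≤p : (w +w zeroW) ≤w walkWeight p
      w≤p with nonemptyWalkToPath (ix≢jy ∘ ends×-injective m) p
      ... | q , q≡p = subst₂ _≤w_ (sym (+w-identityʳ w)) q≡p (minimal q)

-- Composition as gluing along the link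

link-just : ∀ {m₁ k₂ n} {a : Fin (suc m₁)} {b : Fin (suc k₂)} {x y : Fin n} {w} →
            link a b x y ≡ just w → a ≡ fromℕ m₁ × b ≡ zero × x ≡ y × w ≡ zeroW
link-just {m₁} {a = a} {zero} {x} {y} e with toℕ a ≟ℕ m₁ | x ≟ᶠ y
link-just {m₁} {a = a} {zero} refl | yes a≡m₁ | yes x≡y =
  toℕ-injective (trans a≡m₁ (sym (toℕ-fromℕ m₁))) , refl , x≡y , refl

link-last : ∀ {m₁ k₂ n} (x : Fin n) → link {m₁} {suc k₂} (fromℕ m₁) zero x x ≡ just zeroW
link-last {m₁} x with toℕ (fromℕ m₁) ≟ℕ m₁ | x ≟ᶠ x
... | yes _     | yes _   = refl
... | no  ¬last | _       = ⊥-elim (¬last (toℕ-fromℕ m₁))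
... | yes _     | no x≢x  = ⊥-elim (x≢x refl)

data Side : Set where
  left right : Side

opposite : Side → Side
opposite left  = right
opposite right = left

linkEnd : Side → Fin 2
linkEnd left  = suc zero
linkEnd right = zero

module Glue {n} (m : Side → ℕ) (G : (s : Side) → Graph (suc (suc (m s))) n) where

  columns : Side → ℕ
  columns s = suc (suc (m s))

  Glued : Set
  Glued = Σ Side (λ s → V (columns s) n)

  linkColumn : (s : Side) → Fin (columns s)
  linkColumn s = ends (m s) (linkEnd s)

  data GlueEdge : Glued → Glued → Weight → Set where
    inside : ∀ {s a b w} → Edge (G s) a b w → GlueEdge (s , a) (s , b) w
    across : ∀ s x → GlueEdge (s , (linkColumn s , x)) (opposite s , (linkColumn (opposite s) , x)) zeroW

  insideWalk : ∀ {s a b} → Walk (Edge (G s)) a b → Walk GlueEdge (s , a) (s , b)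
  insideWalk {s} = mapWalk (s ,_) inside

  walkWeight-insideWalk : ∀ {s a b} (q : Walk (Edge (G s)) a b) → walkWeight (insideWalk q) ≡ walkWeight q
  walkWeight-insideWalk {s} = walkWeight-map (s ,_) inside

  Composite : Graph (columns left + columns right) n
  Composite = G left ⊙ G right

  flatten : Glued → V (columns left + columns right) n
  flatten (left  , (i , x)) = i ↑ˡ columns right , x
  flatten (right , (i , x)) = columns left ↑ʳ i , x

  unflatten : V (columns left + columns right) n → Glued
  unflatten (i , x) with splitAt (columns left) i
  ... | inj₁ i′ = left  , (i′ , x)
  ... | inj₂ i′ = right , (i′ , x)

  flatten-unflatten : ∀ u → flatten (unflatten u) ≡ u
  flatten-unflatten (i , x) with splitAt (columns left) i in eq
  ... | inj₁ _ = cong (_, x) (splitAt⁻¹-↑ˡ eq)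
  ... | inj₂ _ = cong (_, x) (splitAt⁻¹-↑ʳ eq)

  unflatten-flatten : ∀ a → unflatten (flatten a) ≡ a
  unflatten-flatten (left  , (i , x)) rewrite splitAt-↑ˡ (columns left) i (columns right) = refl
  unflatten-flatten (right , (i , x)) rewrite splitAt-↑ʳ (columns left) (columns right) i = refl

  composite⇒glue : ∀ {u v w} → Edge Composite u v w → GlueEdge (unflatten u) (unflatten v) w
  composite⇒glue {i , x} {j , y} e with splitAt (columns left) i | splitAt (columns left) j
  ... | inj₁ _ | inj₁ _ = inside e
  ... | inj₂ _ | inj₂ _ = inside e
  ... | inj₁ i′ | inj₂ j′ with link-just {a = i′} {j′} {x} {y} e
  ...   | refl , refl , refl , refl = across left x
  composite⇒glue {i , x} {j , y} e | inj₂ i′ | inj₁ j′ with link-just {a = j′} {i′} {y} {x} e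
  ...   | refl , refl , refl , refl = across right y

  glue⇒composite : ∀ {a b w} → GlueEdge a b w → Edge Composite (flatten a) (flatten b) w
  glue⇒composite (inside {left} {i , _} {j , _} e)
    rewrite splitAt-↑ˡ (columns left) i (columns right) | splitAt-↑ˡ (columns left) j (columns right) = e
  glue⇒composite (inside {right} {i , _} {j , _} e)
    rewrite splitAt-↑ʳ (columns left) (columns right) i | splitAt-↑ʳ (columns left) (columns right) j = e
  glue⇒composite (across left x)
    rewrite splitAt-↑ˡ (columns left) (linkColumn left) (columns right)
          | splitAt-↑ʳ (columns left) (columns right) (linkColumn right) = link-last {suc (m left)} {suc (m right)} x
  glue⇒composite (across right x)
    rewrite splitAt-↑ʳ (columns left) (columns right) (linkColumn right)
          | splitAt-↑ˡ (columns left) (linkColumn left) (columns right) = link-last {suc (m left)} {suc (m right)} x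

  flattenAtMost : ∀ {a b} (p : Walk GlueEdge a b) →
                  WalkAtMost {E = Edge Composite} (flatten a) (flatten b) (walkWeight p)
  flattenAtMost p = atMost-map flatten glue⇒composite (p , ≤w-refl)

  unflattenAtMost : ∀ {u v} (p : Walk (Edge Composite) u v) →
                    WalkAtMost {E = GlueEdge} (unflatten u) (unflatten v) (walkWeight p)
  unflattenAtMost p = atMost-map unflatten (λ {u} {v} → composite⇒glue {u} {v}) (p , ≤w-refl)

  glueToComposite : ∀ {u v} (p : Walk GlueEdge (unflatten u) (unflatten v)) →
                    WalkAtMost {E = Edge Composite} u v (walkWeight p)
  glueToComposite {u} {v} p =
    subst₂ (λ u v → WalkAtMost u v (walkWeight p)) (flatten-unflatten u) (flatten-unflatten v) (flattenAtMost p)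

  compositeToGlue : ∀ {a b} (p : Walk (Edge Composite) (flatten a) (flatten b)) →
                    WalkAtMost {E = GlueEdge} a b (walkWeight p)
  compositeToGlue {a} {b} p =
    subst₂ (λ a b → WalkAtMost a b (walkWeight p)) (unflatten-flatten a) (unflatten-flatten b) (unflattenAtMost p)

  flatten-injective : ∀ {a b} → flatten a ≡ flatten b → a ≡ b
  flatten-injective {a} {b} eq = trans (sym (unflatten-flatten a)) (trans (cong unflatten eq) (unflatten-flatten b))

  ,-injectiveʳ : ∀ {s} {a b : V (columns s) n} → (Glued ∋ (s , a)) ≡ (s , b) → a ≡ b
  ,-injectiveʳ refl = refl

  noNegCycle⇒noNegClosedGlueWalk : NoNegCycle Composite → NoNegClosedWalk GlueEdge
  noNegCycle⇒noNegClosedGlueWalk noNeg =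
    noNegClosedWalk-reflect flatten flattenAtMost (noNegCycle⇒noNegClosedWalk noNeg)

  noNegClosedGlueWalk⇒noNegCycle : NoNegClosedWalk GlueEdge → NoNegCycle Composite
  noNegClosedGlueWalk⇒noNegCycle noNeg =
    noNegClosedWalk⇒noNegCycle (noNegClosedWalk-reflect unflatten unflattenAtMost noNeg)

-- Replacing the glued graphs by their short graphs

module Contraction {n} (m : Side → ℕ) (G : (s : Side) → Graph (suc (suc (m s))) n) (S : Side → Graph 2 n)
                   (short : ∀ s → IsShort (G s) (S s)) (noNeg : ∀ s → NoNegCycle (G s)) where

  module Long  = Glue m G
  module Short = Glue (λ _ → 0) S
  open Long using (inside; across)

  port : Short.Glued → Long.Glued
  port (s , (i , x)) = s , (ends (m s) i , x)

  expandEdge : ∀ {c c′ w} → Short.GlueEdge c c′ w → WalkAtMost {E = Long.GlueEdge} (port c) (port c′) w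
  expandEdge (Short.inside {s} {_ , _} {_ , _} e) = atMost-map (s ,_) inside (shortEdge-walk (short s) e)
  expandEdge (Short.across left x)  = atMost-◅ (across left x) (ε , ≤w-refl)
  expandEdge (Short.across right x) = atMost-◅ (across right x) (ε , ≤w-refl)

  expand : ∀ {c c′} (p : Walk Short.GlueEdge c c′) →
           WalkAtMost {E = Long.GlueEdge} (port c) (port c′) (walkWeight p)
  expand ε             = ε , ≤w-refl
  expand ((_ , e) ◅ p) = atMost-◅◅ (expandEdge e) (expand p)

  shortcutInside : ∀ s {i x j y} (q : Walk (Edge (G s)) (ends (m s) i , x) (ends (m s) j , y)) →
                   WalkAtMost {E = Short.GlueEdge} (s , (i , x)) (s , (j , y)) (walkWeight q)
  shortcutInside s q = atMost-map (s ,_) Short.inside (shortcut (short s) (noNeg s) q)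

  -- split on the side so that Short.linkColumn s = ends 0 (linkEnd s) reduces to linkEnd s
  acrossPort : ∀ s x → Short.GlueEdge (s , (linkEnd s , x)) (opposite s , (linkEnd (opposite s) , x)) zeroW
  acrossPort left  x = Short.across left x
  acrossPort right x = Short.across right x

  -- q is the part of the current segment inside G s walked so far
  contractFrom : ∀ {s i x a} c′ (q : Walk (Edge (G s)) (ends (m s) i , x) a)
                 (p : Walk Long.GlueEdge (s , a) (port c′)) →
                 WalkAtMost {E = Short.GlueEdge} (s , (i , x)) c′ (walkWeight q +w walkWeight p)
  contractFrom (s , _) q ε =
    atMost-weaken (≤w-reflexive (sym (+w-identityʳ _))) (shortcutInside s q)
  contractFrom c′ q ((w , inside e) ◅ p) =
    atMost-weaken (≤w-reflexive (walkWeight-snoc q e _)) (contractFrom c′ (q ◅◅ ((w , e) ◅ ε)) p)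
  contractFrom c′ q ((_ , across s x) ◅ p) =
    atMost-weaken (≤w-reflexive (cong (walkWeight q +w_) (+w-identityˡ _)))
      (atMost-◅◅ (shortcutInside s q) (atMost-◅ (acrossPort s x) (contractFrom c′ ε p)))

  contract : ∀ {c c′} (p : Walk Long.GlueEdge (port c) (port c′)) →
             WalkAtMost {E = Short.GlueEdge} c c′ (walkWeight p)
  contract {_ , _} {c′} p = atMost-weaken (≤w-reflexive (+w-identityˡ _)) (contractFrom c′ ε p)

  closedWalkFrom-nonneg : NoNegClosedWalk Short.GlueEdge →
               ∀ {s a₀ a} (q : Walk (Edge (G s)) a₀ a) (p : Walk Long.GlueEdge (s , a) (s , a₀)) →
               zeroW ≤w (walkWeight q +w walkWeight p)
  closedWalkFrom-nonneg _ {s} q ε =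
    subst (zeroW ≤w_) (sym (+w-identityʳ _)) (noNegCycle⇒noNegClosedWalk (noNeg s) q)
  closedWalkFrom-nonneg noNegShort q ((w , inside e) ◅ p) =
    subst (zeroW ≤w_) (walkWeight-snoc q e _) (closedWalkFrom-nonneg noNegShort (q ◅◅ ((w , e) ◅ ε)) p)
  -- a closed walk leaving G s through the link is rotated to start behind the link, at a port
  closedWalkFrom-nonneg noNegShort q ((_ , across s x) ◅ p) = begin
    zeroW                                     ≤⟨ noNegShort (proj₁ shortCycle) ⟩
    walkWeight (proj₁ shortCycle)             ≤⟨ proj₂ shortCycle ⟩
    walkWeight rotated                        ≡⟨ walkWeight-◅◅ p _ ⟩
    (walkWeight p +w walkWeight (q′ ◅◅ _))    ≡⟨ cong (walkWeight p +w_) (walkWeight-◅◅ q′ _) ⟩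
    (walkWeight p +w (walkWeight q′ +w zeroW)) ≡⟨ cong (walkWeight p +w_) (+w-identityʳ _) ⟩
    (walkWeight p +w walkWeight q′)           ≡⟨ cong (walkWeight p +w_) (Long.walkWeight-insideWalk q) ⟩
    (walkWeight p +w walkWeight q)            ≡⟨ +w-comm (walkWeight p) (walkWeight q) ⟩
    (walkWeight q +w walkWeight p)            ≡⟨ cong (walkWeight q +w_) (sym (+w-identityˡ _)) ⟩
    (walkWeight q +w (zeroW +w walkWeight p)) ∎
    where
      open ≤w-Reasoning
      q′ : Walk Long.GlueEdge (s , _) (s , (Long.linkColumn s , x))
      q′ = Long.insideWalk q
      behindLink : Short.Glued
      behindLink = opposite s , (linkEnd (opposite s) , x)
      rotated : Walk Long.GlueEdge (port behindLink) (port behindLink)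
      rotated = p ◅◅ (q′ ◅◅ ((zeroW , across s x) ◅ ε))
      shortCycle : WalkAtMost {E = Short.GlueEdge} behindLink behindLink (walkWeight rotated)
      shortCycle = contract rotated

  noNegClosedWalk-long : NoNegClosedWalk Short.GlueEdge → NoNegClosedWalk Long.GlueEdge
  noNegClosedWalk-long noNegShort p =
    subst (zeroW ≤w_) (+w-identityˡ _) (closedWalkFrom-nonneg noNegShort ε p)

  noNegClosedWalk-short : NoNegClosedWalk Long.GlueEdge → NoNegClosedWalk Short.GlueEdge
  noNegClosedWalk-short = noNegClosedWalk-reflect port expand

  port-injective : ∀ {c c′} → port c ≡ port c′ → c ≡ c′
  port-injective {s , (i , x)} {_ , (j , y)} eq with ,-injectiveˡ eq
  ... | refl = cong (s ,_) (ends×-injective (m s) (Long.,-injectiveʳ eq))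

  portMap : V (Short.columns left + Short.columns right) n → V (Long.columns left + Long.columns right) n
  portMap = Long.flatten ∘ port ∘ Short.unflatten

  portMap-injective : ∀ {u v} → portMap u ≡ portMap v → u ≡ v
  portMap-injective {u} {v} eq = begin
    u                                  ≡⟨ sym (Short.flatten-unflatten u) ⟩
    Short.flatten (Short.unflatten u)  ≡⟨ cong Short.flatten (port-injective (Long.flatten-injective eq)) ⟩
    Short.flatten (Short.unflatten v)  ≡⟨ Short.flatten-unflatten v ⟩
    v                                  ∎
    where open ≡-Reasoning

  portMap-ends : ∀ i x → portMap (ends 2 i , x) ≡ (ends (m left + Long.columns right) i , x)
  portMap-ends zero       x = refl
  portMap-ends (suc zero) x = cong (_, x) (toℕ-injective (begin
    toℕ (Long.columns left ↑ʳ fromℕ (suc (m right)))  ≡⟨ toℕ-↑ʳ (Long.columns left) _ ⟩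
    Long.columns left + toℕ (fromℕ (suc (m right)))   ≡⟨ cong (λ k → Long.columns left + k) (toℕ-fromℕ _) ⟩
    Long.columns left + suc (m right)                 ≡⟨ cong suc (sym (+-suc (m left) (suc (m right)))) ⟩
    suc (m left + Long.columns right)                 ≡⟨ sym (toℕ-fromℕ _) ⟩
    toℕ (fromℕ (suc (m left + Long.columns right)))   ∎))
    where open ≡-Reasoning

  expandComposite : ∀ {u v} (p : Walk (Edge Short.Composite) u v) →
                    WalkAtMost {E = Edge Long.Composite} (portMap u) (portMap v) (walkWeight p)
  expandComposite p = atMost-via Long.flattenAtMost (atMost-via expand (Short.unflattenAtMost p))

  contractComposite : ∀ {u v} (p : Walk (Edge Long.Composite) (portMap u) (portMap v)) →
                      WalkAtMost {E = Edge Short.Composite} u v (walkWeight p)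
  contractComposite p = atMost-via Short.glueToComposite (atMost-via contract (Long.compositeToGlue p))

  composite-noNegCycle⇔ : NoNegCycle Short.Composite ⇔ NoNegCycle Long.Composite
  composite-noNegCycle⇔ = mk⇔
    (Long.noNegClosedGlueWalk⇒noNegCycle ∘ noNegClosedWalk-long ∘ Short.noNegCycle⇒noNegClosedGlueWalk)
    (Short.noNegClosedGlueWalk⇒noNegCycle ∘ noNegClosedWalk-short ∘ Long.noNegCycle⇒noNegClosedGlueWalk)

  composite-short : NoNegCycle Long.Composite →
                    Σ (Graph 2 n) (λ S′ → IsShort Short.Composite S′ × IsShort Long.Composite S′)
  composite-short noNegLong with canonicalForm Long.Composite noNegLong
  ... | C , C-canonical =
    S′ ,
    ( (λ u v → C (portMap u) (portMap v))
    , IsCanonical-pullback portMap portMap-injective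
        (λ u≢v → pathAtMost-via (u≢v ∘ portMap-injective) expandComposite)
        (λ u≢v → pathAtMost-via u≢v contractComposite)
        C-canonical
    , λ i x j y → cong₂ C (sym (portMap-ends i x)) (sym (portMap-ends j y)) ) ,
    (C , C-canonical , λ _ _ _ _ → refl)
    where
      S′ : Graph 2 n
      S′ (i , x) (j , y) = C (ends (m left + Long.columns right) i , x) (ends (m left + Long.columns right) j , y)

lemma10 : ∀ {n m₁ m₂ : ℕ} (G₁ : Graph (suc (suc m₁)) (suc n)) (G₂ : Graph (suc (suc m₂)) (suc n)) →
    NoNegCycle G₁ → NoNegCycle G₂ →
    ∀ (S₁ S₂ : Graph 2 (suc n)) → IsShort G₁ S₁ → IsShort G₂ S₂ →
    (NoNegCycle (S₁ ⊙ S₂) ⇔ NoNegCycle (G₁ ⊙ G₂)) ×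
    (NoNegCycle (G₁ ⊙ G₂) →
    Σ (Graph 2 (suc n)) (λ S → IsShort (S₁ ⊙ S₂) S × IsShort (G₁ ⊙ G₂) S))
lemma10 {n} {m₁} {m₂} G₁ G₂ noNeg₁ noNeg₂ S₁ S₂ short₁ short₂ =
  composite-noNegCycle⇔ , composite-short
  where
    m : Side → ℕ
    m left  = m₁
    m right = m₂

    G : (s : Side) → Graph (suc (suc (m s))) (suc n)
    G left  = G₁
    G right = G₂

    S : Side → Graph 2 (suc n)
    S left  = S₁
    S right = S₂

    short : ∀ s → IsShort (G s) (S s)
    short left  = short₁
    short right = short₂

    noNeg : ∀ s → NoNegCycle (G s)
    noNeg left  = noNeg₁
    noNeg right = noNeg₂

    open Contraction m G S short noNeg
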